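{- Let $A=\{a_1<\dots<a_m\}$, $B=\{b_1<\dots<b_n\}$, $O=A\times B$, $X$ the set of monotone non-decreasing maps $A\to B$, $Y$ the set of monotone non-decreasing maps $B\to A$, and $G(x,y)=\{(a,b)\in O: x(a)=b,\ y(b)=a\}$. Then the game correspondence $G$ is tight, and every game form $g\in G$ is tight.
   Context: For a game correspondence $H:X\times Y\to 2^O$ (with all $H(x,y)\neq\emptyset$) set $C_x=\bigcup_{y\in Y}H(x,y)$ and $D_y=\bigcup_{x\in X}H(x,y)$. $H$ is tight if the hypergraphs $\{C_x\}_{x\in X}$ and $\{D_y\}_{y\in Y}$ are dual, i.e. $C_x\cap D_y\neq\emptyset$ for all $x,y$, and for every $D'\subseteq O$ meeting every $C_x$ there is $y\in Y$ with $D_y\subseteq D'$. A game form $g:X\times Y\to O$ is identified with the correspondence $(x,y)\mapsto\{g(x,y)\}$; $g\in G$ means $g(x,y)\in G(x,y)$ for all $(x,y)$. -}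

module Defs where

open import Level using (0ℓ)
open import Data.Nat using (ℕ; suc)
open import Data.Fin using (Fin; _≤_)
open import Data.Product using (Σ; ∃; _×_; _,_)
open import Relation.Unary using (Pred; Decidable)
open import Relation.Binary.PropositionalEquality using (_≡_)

Correspondence : Set → Set → Set → Set₁
Correspondence X Y O = X → Y → Pred O 0ℓ

module _ {X Y O : Set} (H : Correspondence X Y O) where

  IsGameCorrespondence : Set
  IsGameCorrespondence = ∀ x y → ∃ λ o → H x y o

  C : X → Pred O 0ℓ
  C x o = ∃ λ y → H x y o

  D : Y → Pred O 0ℓ
  D y o = ∃ λ x → H x y o

  -- {C_x} and {D_y} are dual hypergraphs
  Tight : Set₁
  Tight =
    (∀ x y → ∃ λ o → C x o × D y o)
    × (∀ (D' : Pred O 0ℓ) → Decidable D' →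
         (∀ x → ∃ λ o → C x o × D' o) →
         ∃ λ y → ∀ o → D y o → D' o)

formCorr : {X Y O : Set} → (X → Y → O) → Correspondence X Y O
formCorr g x y o = g x y ≡ o

_∈G_ : {X Y O : Set} → (X → Y → O) → Correspondence X Y O → Set
g ∈G H = ∀ x y → H x y (g x y)

Monotone : ℕ → ℕ → Set
Monotone k l = Σ (Fin k → Fin l) λ f → ∀ {i j : Fin k} → i ≤ j → f i ≤ f j

-- The example: A = {a_1<…<a_m} ≅ Fin m, B ≅ Fin n (m, n ≥ 1 written as suc).
module Chains (m n : ℕ) where
  A : Set
  A = Fin (suc m)
  B : Set
  B = Fin (suc n)
  O : Set
  O = A × B
  X : Set
  X = Monotone (suc m) (suc n)
  Y : Set
  Y = Monotone (suc n) (suc m)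

  G : Correspondence X Y O
  G (x , _) (y , _) (a , b) = (x a ≡ b) × (y b ≡ a)

-- Fixed point: for monotone x : A → B and y : B → A, the least a with y (x a) ≤ a is a fixed
-- point of y ∘ x (apply y ∘ x once more and use minimality), so (a , x a) ∈ G(x,y) ≠ ∅.
-- Duality: for every decidable R ⊆ A × B, either the graph of some monotone y : B → A lies in R,
-- or the graph of some monotone x : A → B misses R. By induction on B with a lower bound l on
-- the values of y: let a₀ be the least a ≥ l with (a , b₁) ∈ R. If there is none, the constant
-- map b₁ avoids R above l. Otherwise recurse on B ∖ {b₁} with bound a₀; a section y′ extends by
-- y(b₁) = a₀, and an avoider x′ above a₀ extends by sending every a with l ≤ a < a₀ to b₁.
-- Any correspondence H with every H(x,y) nonempty and inside graph x ∩ graph y — G itself and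
-- every game form g ∈ G — has C_x ⊆ graph x and D_y ⊆ graph y, and is tight by duality.
module Submission where

open import Defs
open import Level using (0ℓ)
open import Data.Nat using (ℕ; zero; suc; z≤n; s≤s)
import Data.Nat.Properties as ℕ
open import Data.Fin using (Fin; _≤_; _<_; _≤?_; fromℕ; fromℕ<) renaming (zero to fzero; suc to fsuc)
open import Data.Fin.Properties using (¬∀⟶∃¬-smallest; any?; ≤fromℕ; ≤-refl; ≤-trans; ≤-antisym; toℕ-injective; toℕ-inject; toℕ-fromℕ<)
open import Data.Product using (Σ; ∃; _×_; _,_; proj₁; proj₂)
open import Data.Empty using (⊥-elim)
open import Function using (_∘_)
open import Data.Sum using (_⊎_; inj₁; inj₂)
open import Relation.Nullary using (¬_; Dec; yes; no; contradiction)
open import Relation.Nullary.Decidable using (decidable-stable; _×-dec_)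
open import Relation.Unary using (Pred; Decidable; ∁)
open import Relation.Unary.Properties using (∁?)
open import Relation.Binary.PropositionalEquality using (_≡_; refl; sym; trans; subst)

least-witness : ∀ {n} {P : Pred (Fin n) 0ℓ} → Decidable P → ∃ P →
                ∃ λ i → P i × (∀ {j} → j < i → ¬ P j)
least-witness {n} {P} P? (i , pᵢ)
  with ¬∀⟶∃¬-smallest n (∁ P) (∁? P?) (λ none → none i pᵢ)
... | k , ¬¬pₖ , below = k , decidable-stable (P? k) ¬¬pₖ , below′
  where
  below′ : ∀ {j} → j < k → ¬ P j
  below′ j<k = subst (∁ P) (toℕ-injective (trans (toℕ-inject _) (toℕ-fromℕ< j<k)))
                     (below (fromℕ< j<k))

monotone-endo-fixedPoint : ∀ m (f : Monotone (suc m) (suc m)) → ∃ λ a → proj₁ f a ≡ a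
monotone-endo-fixedPoint m (f , f-mono)
  with least-witness (λ a → f a ≤? a) (fromℕ m , ≤fromℕ (f (fromℕ m)))
... | a , fa≤a , least = a , ≤-antisym fa≤a (ℕ.≮⇒≥ λ fa<a → least fa<a (f-mono fa≤a))

constant : ∀ {k l} → Fin l → Monotone k l
constant c = (λ _ → c) , λ _ → ≤-refl

prepend : ∀ {k l} (c : Fin l) (y : Monotone (suc k) l) → c ≤ proj₁ y fzero →
          Monotone (suc (suc k)) l
prepend {l = l} c (y , y-mono) c≤y₀ = f , f-mono
  where
  f : Fin (suc (suc _)) → Fin l
  f fzero    = c
  f (fsuc b) = y b
  f-mono : ∀ {i j} → i ≤ j → f i ≤ f j
  f-mono {fzero}  {fzero}  _       = ≤-refl
  f-mono {fzero}  {fsuc j} _       = ≤-trans c≤y₀ (y-mono {fzero} {j} z≤n)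
  f-mono {fsuc i} {fsuc j} (s≤s p) = y-mono p

lift-from : ∀ {k l} (t : Fin k) (x : Monotone k l) → Monotone k (suc l)
lift-from {k} {l} t (x , x-mono) = f , f-mono
  where
  step : (a : Fin k) → Dec (t ≤ a) → Fin (suc l)
  step a (yes _) = fsuc (x a)
  step a (no _)  = fzero
  f : Fin k → Fin (suc l)
  f a = step a (t ≤? a)
  f-mono : ∀ {i j} → i ≤ j → f i ≤ f j
  f-mono {i} {j} i≤j with t ≤? i | t ≤? j
  ... | no _    | _       = z≤n
  ... | yes _   | yes _   = s≤s (x-mono i≤j)
  ... | yes t≤i | no t≰j  = contradiction (≤-trans t≤i i≤j) t≰j

module _ {m : ℕ} where

  GraphWithin : ∀ {n} → (Fin (suc m) → Fin n → Set) → Monotone n (suc m) → Set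
  GraphWithin R (y , _) = ∀ b → R (y b) b

  AvoidsFrom : ∀ {n} → (Fin (suc m) → Fin n → Set) → Fin (suc m) → Monotone (suc m) n → Set
  AvoidsFrom R l (x , _) = ∀ a → l ≤ a → ¬ R a (x a)

  section-or-avoider : ∀ n (R : Fin (suc m) → Fin (suc n) → Set) → (∀ a b → Dec (R a b)) →
    (l : Fin (suc m)) →
    (Σ (Monotone (suc n) (suc m)) λ y → l ≤ proj₁ y fzero × GraphWithin R y)
    ⊎ (Σ (Monotone (suc m) (suc n)) (AvoidsFrom R l))
  section-or-avoider n R R? l with any? (λ a → (l ≤? a) ×-dec R? a fzero)
  ... | no none = inj₂ (constant fzero , λ a l≤a r → none (a , l≤a , r))
  ... | yes hit with least-witness (λ a → (l ≤? a) ×-dec R? a fzero) hit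
  section-or-avoider zero R R? l | yes _ | a₀ , (l≤a₀ , r₀) , _ =
    inj₁ (constant a₀ , l≤a₀ , λ { fzero → r₀ })
  section-or-avoider (suc n) R R? l | yes _ | a₀ , (l≤a₀ , r₀) , least
    with section-or-avoider n (λ a b → R a (fsuc b)) (λ a b → R? a (fsuc b)) a₀
  ... | inj₁ (y , a₀≤y₀ , y⊆R) =
    inj₁ (prepend a₀ y a₀≤y₀ , l≤a₀ , λ { fzero → r₀ ; (fsuc b) → y⊆R b })
  ... | inj₂ (x , x-avoids) = inj₂ (lift-from a₀ x , avoids)
    where
    avoids : AvoidsFrom R l (lift-from a₀ x)
    avoids a l≤a with a₀ ≤? a
    ... | yes a₀≤a = x-avoids a a₀≤a
    ... | no a₀≰a  = λ r → least (ℕ.≰⇒> a₀≰a) (l≤a , r)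

module _ (m n : ℕ) where
  open Chains m n

  graphˣ : X → Pred O 0ℓ
  graphˣ (x , _) (a , b) = x a ≡ b

  graphʸ : Y → Pred O 0ℓ
  graphʸ (y , _) (a , b) = y b ≡ a

  WithinGraphs : Correspondence X Y O → Set
  WithinGraphs H = ∀ x y o → H x y o → graphˣ x o × graphʸ y o

  tight-if-withinGraphs : (H : Correspondence X Y O) →
    IsGameCorrespondence H → WithinGraphs H → Tight H
  tight-if-withinGraphs H nonempty within = meets , blocks
    where
    meets : ∀ x y → ∃ λ o → C H x o × D H y o
    meets x y with nonempty x y
    ... | o , h = o , (y , h) , (x , h)

    blocks : ∀ (D' : Pred O 0ℓ) → Decidable D' → (∀ x → ∃ λ o → C H x o × D' o) →
             ∃ λ y → ∀ o → D H y o → D' o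
    blocks D' D'? hits
      with section-or-avoider n (λ a b → D' (a , b)) (λ a b → D'? (a , b)) fzero
    ... | inj₁ (y , _ , y⊆D') = y , λ { (a , b) (x , h) →
            subst (λ a → D' (a , b)) (proj₂ (within x y (a , b) h)) (y⊆D' b) }
    ... | inj₂ (x , x-avoids) with hits x
    ...   | (a , b) , (y , h) , d =
            ⊥-elim (x-avoids a z≤n
                     (subst (λ b → D' (a , b)) (sym (proj₁ (within x y (a , b) h))) d))

  G-nonempty : IsGameCorrespondence G
  G-nonempty x y with monotone-endo-fixedPoint m (proj₁ y ∘ proj₁ x , λ p → proj₂ y (proj₂ x p))
  ... | a , yxa≡a = (a , proj₁ x a) , refl , yxa≡a

  G-withinGraphs : WithinGraphs G
  G-withinGraphs _ _ _ h = h

  gameForm-withinGraphs : ∀ g → g ∈G G → WithinGraphs (formCorr g)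
  gameForm-withinGraphs g g∈G x y o g≡o = subst (G x y) g≡o (g∈G x y)

mainTheorem2 : (m n : ℕ) →
    IsGameCorrespondence (Chains.G m n)
    × Tight (Chains.G m n)
    × (∀ (g : Chains.X m n → Chains.Y m n → Chains.O m n) →
         g ∈G Chains.G m n → Tight (formCorr g))
mainTheorem2 m n =
  G-nonempty m n ,
  tight-if-withinGraphs m n (Chains.G m n) (G-nonempty m n) (G-withinGraphs m n) ,
  λ g g∈G → tight-if-withinGraphs m n (formCorr g) (λ x y → g x y , refl)
                                   (gameForm-withinGraphs m n g g∈G)
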